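{- Let $n$ be an odd prime and let $k\ge 1$ be less than the multiplicative order of $2$ modulo $n$. Then the number of closed walks of length $k$ in the graph $\Gamma_n$ (i.e. pairs consisting of a starting vertex $v$ and a sequence of $k$ edge choices leading from $v$ back to $v$) is exactly $3^k-2^k$. In particular, if $(a,b)$ is a uniformly random point of $(\mathbb{Z}/n\mathbb{Z})^2$, the probability that a random walk of length $k$ starting at $(a,b)$ ends at $(a,b)$ is at most $\frac{1}{n^2}$.
   Context: $\Gamma_n$ is the directed $3$-regular multigraph with vertex set $(\mathbb{Z}/n\mathbb{Z})^2$ in which each vertex $(a,b)$ has the three outgoing edges $(a,b)\to(a+1,b)$, $(a,b)\to(a,b+1)$, $(a,b)\to(2a,2b)$ (counted with multiplicity); a random walk chooses one of these three edges uniformly and independently at each step. The multiplicative order of $2$ modulo $n$ is the least positive integer $m$ with $2^m\equiv1\pmod n$. -}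

module Defs where

open import Data.Nat using (ℕ; zero; suc; _+_; _*_; _^_; _<_; NonZero)
open import Data.Nat.DivMod using (_mod_; _%_)
open import Data.Fin using (Fin; toℕ) renaming (_≟_ to _≟F_)
open import Data.Product using (_×_; _,_)
open import Data.Product.Properties using (≡-dec)
open import Data.List using (List; []; _∷_; map; concatMap; filter; length; allFin)
open import Data.Vec using (Vec; []; _∷_)
open import Relation.Binary.PropositionalEquality using (_≡_; _≢_)
open import Relation.Nullary using (Dec)

Vertex : ℕ → Set
Vertex n = Fin n × Fin n

step : (n : ℕ) .{{_ : NonZero n}} → Fin 3 → Vertex n → Vertex n
step n Fin.zero (a , b) = ((suc (toℕ a)) mod n , b)
step n (Fin.suc Fin.zero) (a , b) = (a , (suc (toℕ b)) mod n)
step n (Fin.suc (Fin.suc Fin.zero)) (a , b) = ((2 * toℕ a) mod n , (2 * toℕ b) mod n)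

walk : (n : ℕ) .{{_ : NonZero n}} → {k : ℕ} → Vec (Fin 3) k → Vertex n → Vertex n
walk n [] v = v
walk n (c ∷ cs) v = walk n cs (step n c v)

allChoices : (k : ℕ) → List (Vec (Fin 3) k)
allChoices zero = [] ∷ []
allChoices (suc k) = concatMap (λ c → map (c ∷_) (allChoices k)) (allFin 3)

allVertices : (n : ℕ) → List (Vertex n)
allVertices n = concatMap (λ a → map (a ,_) (allFin n)) (allFin n)

_≟V_ : {n : ℕ} → (u v : Vertex n) → Dec (u ≡ v)
_≟V_ = ≡-dec _≟F_ _≟F_

closedWalks : (n : ℕ) .{{_ : NonZero n}} → ℕ → ℕ
closedWalks n k =
  length (concatMap (λ v → filter (λ cs → walk n cs v ≟V v) (allChoices k)) (allVertices n))

IsMultOrder2 : (n : ℕ) .{{_ : NonZero n}} → ℕ → Set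
IsMultOrder2 n m =
  (0 < m) × ((2 ^ m) % n ≡ 1 % n) × (∀ j → 0 < j → j < m → (2 ^ j) % n ≢ 1 % n)

module Submission where

-- Every edge acts on each coordinate of
-- (ℤ/nℤ)² by an affine map x ↦ 2^δ x + t (δ = 1 for the doubling edge), so the walk along cs acts
-- on the two coordinates by x ↦ 2^d x + s₁ and x ↦ 2^d x + s₂, where d counts the doubling steps
-- (walk-affine).  Hence the number of vertices at which cs closes up is the product of the numbers
-- of fixed points of these two affine maps of ℤ/nℤ (closedAt≡fixedPoints).  For an odd prime n and
-- 1 ≤ k < ord_n(2) ≤ n:
--   * if d = 0 the walk is a translation by (s₁, s₂) with s₁ + s₂ = k ≢ 0 (mod n): no fixed point;
--   * if d ≥ 1 then 0 < d ≤ k < ord_n(2), so n ∤ 2^d - 1 and x ↦ (2^d - 1) x + s is a bijection of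
--     ℤ/nℤ; each coordinate map has exactly one fixed point (fixedPoints-unique).
-- Exchanging the sums over vertices and over choice vectors, closedWalks n k is the number of
-- choice vectors that use the doubling edge, 3^k - 2^k; the probability bound follows at once.

open import Defs
open import Algebra.Properties.CommutativeSemigroup using (interchange)
open import Data.Fin using (Fin; toℕ; punchOut) renaming (zero to fzero; suc to fsuc)
open import Data.Fin.Properties
  using (toℕ<n; toℕ-fromℕ<; fromℕ<-cong; fromℕ<-toℕ; toℕ-injective; any?; pigeonhole; punchOut-injective)
  renaming (_≟_ to _≟F_; suc-injective to fsuc-injective; <⇒≢ to <⇒≢ᶠ)
open import Data.List using (List; []; _∷_; _++_; map; concatMap; filter; length; allFin)
open import Data.List.Properties using (map-++; length-++; map-tabulate)
open import Data.Nat
  using (ℕ; zero; suc; _+_; _*_; _^_; _∸_; _≤_; _<_; z≤n; s≤s; z<s; NonZero; >-nonZero; nonTrivial⇒n>1)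
open import Data.Nat.DivMod using (_%_; _/_; _mod_; m≡m%n+[m/n]*n; [m+kn]%n≡m%n; %-remove-+ˡ; m%n<n; m<n⇒m%n≡m)
open import Data.Nat.Divisibility using (_∣_; _∣?_; divides; >⇒∤; ∣m∣n⇒∣m+n)
open import Data.Nat.ListAction using (sum)
open import Data.Nat.ListAction.Properties using (sum-++)
open import Data.Nat.Primality using (Prime; euclidsLemma; prime⇒nonTrivial)
open import Data.Nat.Properties
  using (+-comm; +-assoc; +-identityʳ; +-suc; *-comm; *-assoc; *-identityˡ; *-identityʳ; *-zeroʳ;
         *-distribˡ-+; *-distribˡ-∸; *-distribʳ-∸; [m+n]∸[m+o]≡n∸o; m+n∸n≡m; m∸n+n≡m; m+[n∸m]≡n;
         m∸n≡0⇒m≤n; m∸n≤m; ≤-<-trans; <-≤-trans; ≤-trans; ≤-reflexive; ≤-antisym; ≤-pred; <⇒≤; ≮⇒≥;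
         m<n⇒0<n∸m; m≤n⇒m≤1+n; n<1+n; ^-distribˡ-+-*; m^n>0; ≤∧≢⇒<; *-monoʳ-≤; +-commutativeSemigroup;
         module ≤-Reasoning)
open import Data.Nat.Tactic.RingSolver using (solve-∀)
open import Data.Product using (_×_; _,_; proj₁; proj₂; ∃)
open import Data.Product.Properties using (,-injective)
open import Data.Sum using (inj₁; inj₂)
open import Data.Vec using (Vec; []; _∷_)
open import Function.Bundles using (_⇔_; mk⇔; Equivalence)
open import Function.Properties.Equivalence using () renaming (trans to ⇔-trans)
open import Level using (Level)
open import Relation.Binary.PropositionalEquality
  using (_≡_; _≢_; refl; sym; trans; cong; cong₂; subst; subst₂; module ≡-Reasoning)
open import Relation.Nullary using (Dec; yes; no; ¬_; contradiction)
open import Relation.Unary using (Decidable)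

open Equivalence using (to; from)

∑ : ∀ {a} {A : Set a} → List A → (A → ℕ) → ℕ
∑ xs f = sum (map f xs)

syntax ∑ xs (λ x → e) = ∑[ x ← xs ] e

private variable
  a b : Level
  A B : Set a

∑-cong : ∀ {f g : A → ℕ} (xs : List A) → (∀ x → f x ≡ g x) → ∑ xs f ≡ ∑ xs g
∑-cong []       f≗g = refl
∑-cong (x ∷ xs) f≗g = cong₂ _+_ (f≗g x) (∑-cong xs f≗g)

∑-zero : (xs : List A) → ∑[ _ ← xs ] 0 ≡ 0
∑-zero []       = refl
∑-zero (x ∷ xs) = ∑-zero xs

∑-++ : (xs ys : List A) (f : A → ℕ) → ∑ (xs ++ ys) f ≡ ∑ xs f + ∑ ys f
∑-++ xs ys f = trans (cong sum (map-++ f xs ys)) (sum-++ (map f xs) (map f ys))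

∑-+ : (xs : List A) (f g : A → ℕ) → ∑[ x ← xs ] (f x + g x) ≡ ∑ xs f + ∑ xs g
∑-+ []       f g = refl
∑-+ (x ∷ xs) f g = trans (cong (f x + g x +_) (∑-+ xs f g))
                         (interchange +-commutativeSemigroup (f x) (g x) (∑ xs f) (∑ xs g))

∑-*ˡ : (c : ℕ) (xs : List A) (f : A → ℕ) → ∑[ x ← xs ] (c * f x) ≡ c * ∑ xs f
∑-*ˡ c []       f = sym (*-zeroʳ c)
∑-*ˡ c (x ∷ xs) f = trans (cong (c * f x +_) (∑-*ˡ c xs f)) (sym (*-distribˡ-+ c (f x) (∑ xs f)))

∑-*ʳ : (c : ℕ) (xs : List A) (f : A → ℕ) → ∑[ x ← xs ] (f x * c) ≡ ∑ xs f * c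
∑-*ʳ c xs f = trans (∑-cong xs (λ x → *-comm (f x) c)) (trans (∑-*ˡ c xs f) (*-comm c (∑ xs f)))

∑-map : (g : A → B) (xs : List A) (f : B → ℕ) → ∑ (map g xs) f ≡ ∑[ x ← xs ] f (g x)
∑-map g []       f = refl
∑-map g (x ∷ xs) f = cong (f (g x) +_) (∑-map g xs f)

∑-concatMap : (g : A → List B) (xs : List A) (f : B → ℕ) →
  ∑ (concatMap g xs) f ≡ ∑[ x ← xs ] ∑ (g x) f
∑-concatMap g []       f = refl
∑-concatMap g (x ∷ xs) f = trans (∑-++ (g x) _ f) (cong (∑ (g x) f +_) (∑-concatMap g xs f))

length-concatMap : (g : A → List B) (xs : List A) →
  length (concatMap g xs) ≡ ∑[ x ← xs ] length (g x)
length-concatMap g []       = refl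
length-concatMap g (x ∷ xs) = trans (length-++ (g x)) (cong (length (g x) +_) (length-concatMap g xs))

∑-swap : (xs : List A) (ys : List B) (f : A → B → ℕ) →
  ∑[ x ← xs ] ∑[ y ← ys ] f x y ≡ ∑[ y ← ys ] ∑[ x ← xs ] f x y
∑-swap []       ys f = sym (∑-zero ys)
∑-swap (x ∷ xs) ys f = trans (cong (∑ ys (f x) +_) (∑-swap xs ys f))
                             (sym (∑-+ ys (f x) (λ y → ∑[ x ← xs ] f x y)))

∑-product : (xs : List A) (ys : List B) (f : A → ℕ) (g : B → ℕ) →
  ∑[ x ← xs ] ∑[ y ← ys ] (f x * g y) ≡ ∑ xs f * ∑ ys g
∑-product xs ys f g = trans (∑-cong xs (λ x → ∑-*ˡ (f x) ys g)) (∑-*ʳ (∑ ys g) xs f)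

𝟙 : ∀ {p} {P : Set p} → Dec P → ℕ
𝟙 (yes _) = 1
𝟙 (no _)  = 0

𝟙-cong : ∀ {p q} {P : Set p} {Q : Set q} → P ⇔ Q → (P? : Dec P) (Q? : Dec Q) → 𝟙 P? ≡ 𝟙 Q?
𝟙-cong P⇔Q (yes p) (yes q) = refl
𝟙-cong P⇔Q (yes p) (no ¬q) = contradiction (to P⇔Q p) ¬q
𝟙-cong P⇔Q (no ¬p) (yes q) = contradiction (from P⇔Q q) ¬p
𝟙-cong P⇔Q (no ¬p) (no ¬q) = refl

𝟙-× : ∀ {p q r} {P : Set p} {Q : Set q} {R : Set r} → R ⇔ (P × Q) →
  (R? : Dec R) (P? : Dec P) (Q? : Dec Q) → 𝟙 R? ≡ 𝟙 P? * 𝟙 Q?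
𝟙-× R⇔P×Q (yes r) (yes p) (yes q) = refl
𝟙-× R⇔P×Q (yes r) (no ¬p) Q?      = contradiction (proj₁ (to R⇔P×Q r)) ¬p
𝟙-× R⇔P×Q (yes r) (yes p) (no ¬q) = contradiction (proj₂ (to R⇔P×Q r)) ¬q
𝟙-× R⇔P×Q (no ¬r) (yes p) (yes q) = contradiction (from R⇔P×Q (p , q)) ¬r
𝟙-× R⇔P×Q (no ¬r) (yes p) (no ¬q) = refl
𝟙-× R⇔P×Q (no ¬r) (no ¬p) Q?      = refl

length-filter : ∀ {a p} {A : Set a} {P : A → Set p} (P? : Decidable P) (xs : List A) →
  length (filter P? xs) ≡ ∑[ x ← xs ] 𝟙 (P? x)
length-filter P? []       = refl
length-filter P? (x ∷ xs) with P? x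
... | yes _ = cong suc (length-filter P? xs)
... | no  _ = length-filter P? xs

∑-allFin-suc : ∀ {n} (f : Fin (suc n) → ℕ) → ∑ (allFin (suc n)) f ≡ f fzero + ∑[ x ← allFin n ] f (fsuc x)
∑-allFin-suc {n} f = cong (f fzero +_) (trans (cong (λ xs → ∑ xs f) (sym (map-tabulate (λ x → x) fsuc)))
                                              (∑-map fsuc (allFin n) f))

∑-point : ∀ {n} (x₀ : Fin n) → ∑[ x ← allFin n ] 𝟙 (x ≟F x₀) ≡ 1
∑-point {suc n} fzero     = trans (∑-allFin-suc {n} (λ x → 𝟙 (x ≟F fzero))) (cong suc (∑-zero (allFin n)))
∑-point {suc n} (fsuc x₀) = begin
  ∑[ x ← allFin (suc n) ] 𝟙 (x ≟F fsuc x₀)  ≡⟨ ∑-allFin-suc (λ x → 𝟙 (x ≟F fsuc x₀)) ⟩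
  ∑[ x ← allFin n ] 𝟙 (fsuc x ≟F fsuc x₀)   ≡⟨ ∑-cong (allFin n) (λ x → 𝟙-cong suc⇔ (fsuc x ≟F fsuc x₀) (x ≟F x₀)) ⟩
  ∑[ x ← allFin n ] 𝟙 (x ≟F x₀)             ≡⟨ ∑-point x₀ ⟩
  1                                          ∎
  where
  open ≡-Reasoning
  suc⇔ : ∀ {x} → fsuc x ≡ fsuc x₀ ⇔ x ≡ x₀
  suc⇔ = mk⇔ fsuc-injective (cong fsuc)

injective⇒surjective : ∀ {N} (h : Fin N → Fin N) → (∀ x y → h x ≡ h y → x ≡ y) →
  (t : Fin N) → ∃ λ x → h x ≡ t
injective⇒surjective {suc N} h h-inj t with any? (λ x → h x ≟F t)
... | yes hit = hit
... | no miss =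
  let i , j , i<j , hᵢ≡hⱼ = pigeonhole (n<1+n N) (λ x → punchOut (t≢h x))
  in  contradiction (h-inj i j (punchOut-injective (t≢h i) (t≢h j) hᵢ≡hⱼ)) (<⇒≢ᶠ i<j)
  where
  t≢h : ∀ x → t ≢ h x
  t≢h x t≡hx = miss (x , sym t≡hx)

module _ {n : ℕ} .{{_ : NonZero n}} where

  %-≡⇒∣∸ : ∀ a b → a % n ≡ b % n → n ∣ b ∸ a
  %-≡⇒∣∸ a b eq = divides (b / n ∸ a / n) (begin
    b ∸ a                                      ≡⟨ cong₂ _∸_ (m≡m%n+[m/n]*n b n) (m≡m%n+[m/n]*n a n) ⟩
    (b % n + b / n * n) ∸ (a % n + a / n * n)  ≡⟨ cong (λ r → (b % n + b / n * n) ∸ (r + a / n * n)) eq ⟩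
    (b % n + b / n * n) ∸ (b % n + a / n * n)  ≡⟨ [m+n]∸[m+o]≡n∸o (b % n) _ _ ⟩
    b / n * n ∸ a / n * n                      ≡⟨ *-distribʳ-∸ n (b / n) (a / n) ⟨
    (b / n ∸ a / n) * n                        ∎)
    where open ≡-Reasoning

  [y+z]%n≡z%n⇔n∣y : ∀ y z → (y + z) % n ≡ z % n ⇔ n ∣ y
  [y+z]%n≡z%n⇔n∣y y z = mk⇔
    (λ eq → subst (n ∣_) (m+n∸n≡m y z) (%-≡⇒∣∸ z (y + z) (sym eq)))
    (%-remove-+ˡ z)

  ∣∸⇒≤ : ∀ {a b} → n ∣ b ∸ a → b < n → b ≤ a
  ∣∸⇒≤ {a} {b} n∣b∸a b<n with b ∸ a in eq
  ... | zero  = m∸n≡0⇒m≤n eq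
  ... | suc _ = contradiction n∣b∸a (>⇒∤ (subst (_< n) eq (≤-<-trans (m∸n≤m b a) b<n)))

  ∣∸1⇒%≡1 : ∀ a → 1 ≤ a → n ∣ a ∸ 1 → a % n ≡ 1 % n
  ∣∸1⇒%≡1 a 1≤a n∣a∸1 = subst (λ y → y % n ≡ 1 % n) (m∸n+n≡m 1≤a) (from ([y+z]%n≡z%n⇔n∣y (a ∸ 1) 1) n∣a∸1)

  %-absorb : ∀ a b c → (a * (b % n) + c) % n ≡ (a * b + c) % n
  %-absorb a b c = begin
    (a * (b % n) + c) % n                  ≡⟨ [m+kn]%n≡m%n _ (a * (b / n)) n ⟨
    (a * (b % n) + c + a * (b / n) * n) % n ≡⟨ cong (_% n) (regroup a (b % n) (b / n) n c) ⟩
    (a * (b % n + b / n * n) + c) % n      ≡⟨ cong (λ b′ → (a * b′ + c) % n) (m≡m%n+[m/n]*n b n) ⟨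
    (a * b + c) % n                        ∎
    where
    open ≡-Reasoning
    regroup : ∀ a r q n c → a * r + c + a * q * n ≡ a * (r + q * n) + c
    regroup = solve-∀

-- Fin n as ℤ/nℤ, and affine maps x ↦ E x + s on it.
module _ (n : ℕ) .{{_ : NonZero n}} where

  mod≡mod⇔%≡% : ∀ y z → y mod n ≡ z mod n ⇔ y % n ≡ z % n
  mod≡mod⇔%≡% y z = mk⇔
    (λ eq → trans (sym (toℕ-fromℕ< (m%n<n y n))) (trans (cong toℕ eq) (toℕ-fromℕ< (m%n<n z n))))
    (λ eq → fromℕ<-cong _ _ eq (m%n<n y n) (m%n<n z n))

  toℕ-mod : (x : Fin n) → toℕ x mod n ≡ x
  toℕ-mod x = trans (fromℕ<-cong _ _ (m<n⇒m%n≡m (toℕ<n x)) (m%n<n (toℕ x) n) (toℕ<n x))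
                    (fromℕ<-toℕ x (toℕ<n x))

  affine : ℕ → ℕ → Fin n → Fin n
  affine E s x = (E * toℕ x + s) mod n

  affine-id : (x : Fin n) → affine 1 0 x ≡ x
  affine-id x = trans (cong (_mod n) (trans (+-identityʳ _) (*-identityˡ _))) (toℕ-mod x)

  affine-∘ : ∀ E s F t x → affine F t (affine E s x) ≡ affine (F * E) (F * s + t) x
  affine-∘ E s F t x = from (mod≡mod⇔%≡% _ _) (begin
    (F * toℕ ((E * toℕ x + s) mod n) + t) % n ≡⟨ cong (λ r → (F * r + t) % n) (toℕ-fromℕ< (m%n<n _ n)) ⟩
    (F * ((E * toℕ x + s) % n) + t) % n      ≡⟨ %-absorb F _ t ⟩
    (F * (E * toℕ x + s) + t) % n            ≡⟨ cong (_% n) (expand F E (toℕ x) s t) ⟩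
    (F * E * toℕ x + (F * s + t)) % n        ∎)
    where
    open ≡-Reasoning
    expand : ∀ F E x s t → F * (E * x + s) + t ≡ F * E * x + (F * s + t)
    expand = solve-∀

  affine-fixed⇔ : ∀ F s x → affine (1 + F) s x ≡ x ⇔ n ∣ F * toℕ x + s
  affine-fixed⇔ F s x = ⇔-trans fixed⇔residue ([y+z]%n≡z%n⇔n∣y (F * toℕ x + s) (toℕ x))
    where
    regroup : (1 + F) * toℕ x + s ≡ F * toℕ x + s + toℕ x
    regroup = trans (+-assoc (toℕ x) _ s) (+-comm (toℕ x) _)
    fixed⇔residue : affine (1 + F) s x ≡ x ⇔ (F * toℕ x + s + toℕ x) % n ≡ toℕ x % n
    fixed⇔residue = subst₂ (λ y x′ → y mod n ≡ x′ ⇔ (F * toℕ x + s + toℕ x) % n ≡ toℕ x % n)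
                           (sym regroup) (toℕ-mod x) (mod≡mod⇔%≡% (F * toℕ x + s + toℕ x) (toℕ x))

  mod≡0⇔∣ : ∀ y → y mod n ≡ 0 mod n ⇔ n ∣ y
  mod≡0⇔∣ y = ⇔-trans (mod≡mod⇔%≡% y 0) (mk⇔
    (λ eq → %-≡⇒∣∸ 0 y (sym eq))
    (λ n∣y → trans (cong (_% n) (sym (+-identityʳ y))) (%-remove-+ˡ 0 n∣y)))

  affine-injective : Prime n → ∀ F s → ¬ n ∣ F → ∀ x y → affine F s x ≡ affine F s y → x ≡ y
  affine-injective pr F s n∤F x y eq = toℕ-injective (≤-antisym (≥-of x y (sym eq)) (≥-of y x eq))
    where
    ≥-of : ∀ x y → affine F s y ≡ affine F s x → toℕ x ≤ toℕ y
    ≥-of x y eq with euclidsLemma F (toℕ x ∸ toℕ y) pr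
                       (subst (n ∣_) difference (%-≡⇒∣∸ _ _ (to (mod≡mod⇔%≡% _ _) eq)))
      where
      difference : F * toℕ x + s ∸ (F * toℕ y + s) ≡ F * (toℕ x ∸ toℕ y)
      difference = begin
        F * toℕ x + s ∸ (F * toℕ y + s)  ≡⟨ cong₂ _∸_ (+-comm _ s) (+-comm _ s) ⟩
        s + F * toℕ x ∸ (s + F * toℕ y)  ≡⟨ [m+n]∸[m+o]≡n∸o s _ _ ⟩
        F * toℕ x ∸ F * toℕ y            ≡⟨ *-distribˡ-∸ F (toℕ x) (toℕ y) ⟨
        F * (toℕ x ∸ toℕ y)              ∎
        where open ≡-Reasoning
    ... | inj₁ n∣F   = contradiction n∣F n∤F
    ... | inj₂ n∣x∸y = ∣∸⇒≤ n∣x∸y (toℕ<n x)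

  fixedPoints : ℕ → ℕ → ℕ
  fixedPoints E s = ∑[ x ← allFin n ] 𝟙 (affine E s x ≟F x)

  fixedPoints-translation : ∀ s → ¬ n ∣ s → fixedPoints 1 s ≡ 0
  fixedPoints-translation s n∤s = trans (∑-cong (allFin n) no-fixed-point) (∑-zero (allFin n))
    where
    no-fixed-point : ∀ x → 𝟙 (affine 1 s x ≟F x) ≡ 0
    no-fixed-point x with affine 1 s x ≟F x
    ... | yes fixed = contradiction (to (affine-fixed⇔ 0 s x) fixed) n∤s
    ... | no  _     = refl

  -- over a prime modulus, x ↦ (1 + F) x + s has exactly one fixed point unless n divides F:
  -- the fixed points are the roots of the bijection x ↦ F x + s
  fixedPoints-unique : Prime n → ∀ F s → ¬ n ∣ F → fixedPoints (1 + F) s ≡ 1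
  fixedPoints-unique pr F s n∤F =
    trans (∑-cong (allFin n) (λ x → 𝟙-cong (fixed⇔root x) _ (x ≟F x₀))) (∑-point x₀)
    where
    injective : ∀ x y → affine F s x ≡ affine F s y → x ≡ y
    injective = affine-injective pr F s n∤F
    root : ∃ λ x → affine F s x ≡ 0 mod n
    root = injective⇒surjective (affine F s) injective (0 mod n)
    x₀ : Fin n
    x₀ = proj₁ root
    x₀-root : n ∣ F * toℕ x₀ + s
    x₀-root = to (mod≡0⇔∣ _) (proj₂ root)
    fixed⇔root : ∀ x → affine (1 + F) s x ≡ x ⇔ x ≡ x₀
    fixed⇔root x = mk⇔
      (λ fixed → injective x x₀ (trans (from (mod≡0⇔∣ _) (to (affine-fixed⇔ F s x) fixed))
                                       (sym (from (mod≡0⇔∣ _) x₀-root))))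
      (λ { refl → from (affine-fixed⇔ F s x₀) x₀-root })

-- The multiplicative order of 2 modulo n.
module _ {n : ℕ} .{{_ : NonZero n}} where

  below-order : ∀ {m} → IsMultOrder2 n m → ∀ d → 0 < d → d < m → ¬ n ∣ 2 ^ d ∸ 1
  below-order (_ , _ , minimal) d 0<d d<m n∣2^d∸1 = minimal d 0<d d<m (∣∸1⇒%≡1 (2 ^ d) (m^n>0 2 d) n∣2^d∸1)

  cancel-2^ : Prime n → ¬ n ∣ 2 → ∀ i y → n ∣ 2 ^ i * y → n ∣ y
  cancel-2^ pr n∤2 zero    y n∣y = subst (n ∣_) (+-identityʳ y) n∣y
  cancel-2^ pr n∤2 (suc i) y n∣2^[1+i]y with euclidsLemma 2 (2 ^ i * y) pr (subst (n ∣_) (*-assoc 2 (2 ^ i) y) n∣2^[1+i]y)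
  ... | inj₁ n∣2     = contradiction n∣2 n∤2
  ... | inj₂ n∣2^i*y = cancel-2^ pr n∤2 i y n∣2^i*y

  -- the order of 2 modulo an odd prime n is at most n: two of 2⁰, …, 2ⁿ agree mod n
  order≤n : Prime n → ¬ n ∣ 2 → ∀ {m} → IsMultOrder2 n m → m ≤ n
  order≤n pr n∤2 {m} order with pigeonhole (n<1+n n) (λ (i : Fin (suc n)) → (2 ^ toℕ i) mod n)
  ... | i , j , i<j , 2^i≡2^j = begin
    m               ≤⟨ ≮⇒≥ (λ d<m → below-order order d (m<n⇒0<n∸m i<j) d<m n∣2^d∸1) ⟩
    toℕ j ∸ toℕ i   ≤⟨ m∸n≤m (toℕ j) (toℕ i) ⟩
    toℕ j           ≤⟨ ≤-pred (toℕ<n j) ⟩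
    n               ∎
    where
    open ≤-Reasoning
    d : ℕ
    d = toℕ j ∸ toℕ i
    difference : 2 ^ toℕ j ∸ 2 ^ toℕ i ≡ 2 ^ toℕ i * (2 ^ d ∸ 1)
    difference = begin-equality
      2 ^ toℕ j ∸ 2 ^ toℕ i                  ≡⟨ cong (λ e → 2 ^ e ∸ 2 ^ toℕ i) (m+[n∸m]≡n (<⇒≤ i<j)) ⟨
      2 ^ (toℕ i + d) ∸ 2 ^ toℕ i            ≡⟨ cong₂ _∸_ (^-distribˡ-+-* 2 (toℕ i) d) (sym (*-identityʳ (2 ^ toℕ i))) ⟩
      2 ^ toℕ i * 2 ^ d ∸ 2 ^ toℕ i * 1      ≡⟨ *-distribˡ-∸ (2 ^ toℕ i) (2 ^ d) 1 ⟨
      2 ^ toℕ i * (2 ^ d ∸ 1)                ∎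
    n∣2^d∸1 : n ∣ 2 ^ d ∸ 1
    n∣2^d∸1 = cancel-2^ pr n∤2 (toℕ i) _
      (subst (n ∣_) difference (%-≡⇒∣∸ _ _ (to (mod≡mod⇔%≡% n _ _) 2^i≡2^j)))

-- Walks act coordinatewise by affine maps.

sgn : ℕ → ℕ
sgn zero    = 0
sgn (suc _) = 1

-- the doubling edge multiplies both coordinates by 2¹, the translations by 2⁰
doubles : Fin 3 → ℕ
doubles fzero               = 0
doubles (fsuc fzero)        = 0
doubles (fsuc (fsuc fzero)) = 1

doublings : ∀ {k} → Vec (Fin 3) k → ℕ
doublings []       = 0
doublings (c ∷ cs) = doubles c + doublings cs

move₁ move₂ : Fin 3 → ℕ
move₁ fzero               = 1
move₁ (fsuc fzero)        = 0
move₁ (fsuc (fsuc fzero)) = 0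
move₂ fzero               = 0
move₂ (fsuc fzero)        = 1
move₂ (fsuc (fsuc fzero)) = 0

-- the translation part of the affine map by which a walk acts on a coordinate moved by `move`
shift : ∀ {k} → (Fin 3 → ℕ) → Vec (Fin 3) k → ℕ
shift move []       = 0
shift move (c ∷ cs) = 2 ^ doublings cs * move c + shift move cs

doublings≤length : ∀ {k} (cs : Vec (Fin 3) k) → doublings cs ≤ k
doublings≤length []                        = z≤n
doublings≤length (fzero ∷ cs)              = m≤n⇒m≤1+n (doublings≤length cs)
doublings≤length (fsuc fzero ∷ cs)         = m≤n⇒m≤1+n (doublings≤length cs)
doublings≤length (fsuc (fsuc fzero) ∷ cs)  = s≤s (doublings≤length cs)

translation-length : ∀ {k} (cs : Vec (Fin 3) k) → doublings cs ≡ 0 → shift move₁ cs + shift move₂ cs ≡ k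
translation-length []                    _      = refl
translation-length (fzero ∷ cs)          no-dbl rewrite no-dbl = cong suc (translation-length cs no-dbl)
translation-length (fsuc fzero ∷ cs)     no-dbl rewrite no-dbl =
  trans (+-suc (shift move₁ cs) (shift move₂ cs)) (cong suc (translation-length cs no-dbl))
translation-length (fsuc (fsuc fzero) ∷ cs) ()

module _ (n : ℕ) .{{_ : NonZero n}} where

  step₁ : ∀ c (v : Vertex n) → proj₁ (step n c v) ≡ affine n (2 ^ doubles c) (move₁ c) (proj₁ v)
  step₁ fzero               v = cong (_mod n) (sym (trans (+-comm _ 1) (cong suc (*-identityˡ _))))
  step₁ (fsuc fzero)        v = sym (affine-id n (proj₁ v))
  step₁ (fsuc (fsuc fzero)) v = cong (_mod n) (sym (+-identityʳ _))

  step₂ : ∀ c (v : Vertex n) → proj₂ (step n c v) ≡ affine n (2 ^ doubles c) (move₂ c) (proj₂ v)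
  step₂ fzero               v = sym (affine-id n (proj₂ v))
  step₂ (fsuc fzero)        v = cong (_mod n) (sym (trans (+-comm _ 1) (cong suc (*-identityˡ _))))
  step₂ (fsuc (fsuc fzero)) v = cong (_mod n) (sym (+-identityʳ _))

  walk-coordinate : (π : Vertex n → Fin n) (move : Fin 3 → ℕ) →
    (∀ c v → π (step n c v) ≡ affine n (2 ^ doubles c) (move c) (π v)) →
    ∀ {k} (cs : Vec (Fin 3) k) v → π (walk n cs v) ≡ affine n (2 ^ doublings cs) (shift move cs) (π v)
  walk-coordinate π move π-step []       v = sym (affine-id n (π v))
  walk-coordinate π move π-step (c ∷ cs) v = begin
    π (walk n cs (step n c v))
      ≡⟨ walk-coordinate π move π-step cs (step n c v) ⟩
    affine n (2 ^ doublings cs) (shift move cs) (π (step n c v))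
      ≡⟨ cong (affine n (2 ^ doublings cs) (shift move cs)) (π-step c v) ⟩
    affine n (2 ^ doublings cs) (shift move cs) (affine n (2 ^ doubles c) (move c) (π v))
      ≡⟨ affine-∘ n (2 ^ doubles c) (move c) (2 ^ doublings cs) (shift move cs) (π v) ⟩
    affine n (2 ^ doublings cs * 2 ^ doubles c) (shift move (c ∷ cs)) (π v)
      ≡⟨ cong (λ E → affine n E (shift move (c ∷ cs)) (π v)) powers ⟩
    affine n (2 ^ doublings (c ∷ cs)) (shift move (c ∷ cs)) (π v) ∎
    where
    open ≡-Reasoning
    powers : 2 ^ doublings cs * 2 ^ doubles c ≡ 2 ^ (doubles c + doublings cs)
    powers = trans (*-comm (2 ^ doublings cs) (2 ^ doubles c)) (sym (^-distribˡ-+-* 2 (doubles c) (doublings cs)))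

  walk-affine : ∀ {k} (cs : Vec (Fin 3) k) (a b : Fin n) →
    walk n cs (a , b) ≡ (affine n (2 ^ doublings cs) (shift move₁ cs) a , affine n (2 ^ doublings cs) (shift move₂ cs) b)
  walk-affine cs a b = cong₂ _,_ (walk-coordinate proj₁ move₁ step₁ cs (a , b))
                                 (walk-coordinate proj₂ move₂ step₂ cs (a , b))

  closedAt : ∀ {k} → Vec (Fin 3) k → ℕ
  closedAt cs = ∑[ v ← allVertices n ] 𝟙 (walk n cs v ≟V v)

  closedWalks≡∑closedAt : ∀ k → closedWalks n k ≡ ∑[ cs ← allChoices k ] closedAt cs
  closedWalks≡∑closedAt k = begin
    closedWalks n k
      ≡⟨ length-concatMap (λ v → filter (λ cs → walk n cs v ≟V v) (allChoices k)) (allVertices n) ⟩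
    ∑[ v ← allVertices n ] length (filter (λ cs → walk n cs v ≟V v) (allChoices k))
      ≡⟨ ∑-cong (allVertices n) (λ v → length-filter (λ cs → walk n cs v ≟V v) (allChoices k)) ⟩
    ∑[ v ← allVertices n ] ∑[ cs ← allChoices k ] 𝟙 (walk n cs v ≟V v)
      ≡⟨ ∑-swap (allVertices n) (allChoices k) (λ v cs → 𝟙 (walk n cs v ≟V v)) ⟩
    ∑[ cs ← allChoices k ] closedAt cs ∎
    where open ≡-Reasoning

  closedAt≡fixedPoints : ∀ {k} (cs : Vec (Fin 3) k) →
    closedAt cs ≡ fixedPoints n (2 ^ doublings cs) (shift move₁ cs) * fixedPoints n (2 ^ doublings cs) (shift move₂ cs)
  closedAt≡fixedPoints cs = begin
    ∑[ v ← allVertices n ] 𝟙 (walk n cs v ≟V v)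
      ≡⟨ ∑-concatMap (λ a → map (a ,_) (allFin n)) (allFin n) _ ⟩
    ∑[ a ← allFin n ] ∑ (map (a ,_) (allFin n)) (λ v → 𝟙 (walk n cs v ≟V v))
      ≡⟨ ∑-cong (allFin n) (λ a → ∑-map (a ,_) (allFin n) _) ⟩
    ∑[ a ← allFin n ] ∑[ b ← allFin n ] 𝟙 (walk n cs (a , b) ≟V (a , b))
      ≡⟨ ∑-cong (allFin n) (λ a → ∑-cong (allFin n) (λ b → 𝟙-× (closed⇔fixed a b) _ (f₁ a ≟F a) (f₂ b ≟F b))) ⟩
    ∑[ a ← allFin n ] ∑[ b ← allFin n ] (𝟙 (f₁ a ≟F a) * 𝟙 (f₂ b ≟F b))
      ≡⟨ ∑-product (allFin n) (allFin n) _ _ ⟩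
    fixedPoints n E (shift move₁ cs) * fixedPoints n E (shift move₂ cs) ∎
    where
    open ≡-Reasoning
    E : ℕ
    E = 2 ^ doublings cs
    f₁ f₂ : Fin n → Fin n
    f₁ = affine n E (shift move₁ cs)
    f₂ = affine n E (shift move₂ cs)
    closed⇔fixed : ∀ a b → walk n cs (a , b) ≡ (a , b) ⇔ (f₁ a ≡ a × f₂ b ≡ b)
    closed⇔fixed a b rewrite walk-affine cs a b = mk⇔ ,-injective (λ (p , q) → cong₂ _,_ p q)

  closedAt-translation : ∀ {k} (cs : Vec (Fin 3) k) → doublings cs ≡ 0 → ¬ n ∣ k → closedAt cs ≡ 0
  closedAt-translation cs no-dbl n∤k
    rewrite closedAt≡fixedPoints cs | no-dbl with n ∣? shift move₁ cs
  ... | no n∤s₁ = cong (_* fixedPoints n 1 (shift move₂ cs)) (fixedPoints-translation n _ n∤s₁)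
  ... | yes n∣s₁ = trans (cong (fixedPoints n 1 (shift move₁ cs) *_) (fixedPoints-translation n _ n∤s₂))
                         (*-zeroʳ (fixedPoints n 1 (shift move₁ cs)))
    where
    n∤s₂ : ¬ n ∣ shift move₂ cs
    n∤s₂ n∣s₂ = n∤k (subst (n ∣_) (translation-length cs no-dbl) (∣m∣n⇒∣m+n n∣s₁ n∣s₂))

  closedAt-doubling : Prime n → ∀ {k} (cs : Vec (Fin 3) k) → ¬ n ∣ 2 ^ doublings cs ∸ 1 → closedAt cs ≡ 1
  closedAt-doubling pr cs n∤2^d∸1 = begin
    closedAt cs                                              ≡⟨ closedAt≡fixedPoints cs ⟩
    fixedPoints n E (shift move₁ cs) * fixedPoints n E (shift move₂ cs)
      ≡⟨ cong₂ (λ E′ E″ → fixedPoints n E′ (shift move₁ cs) * fixedPoints n E″ (shift move₂ cs)) E≡1+F E≡1+F ⟩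
    fixedPoints n (1 + F) (shift move₁ cs) * fixedPoints n (1 + F) (shift move₂ cs)
      ≡⟨ cong₂ _*_ (fixedPoints-unique n pr F _ n∤2^d∸1) (fixedPoints-unique n pr F _ n∤2^d∸1) ⟩
    1                                                        ∎
    where
    open ≡-Reasoning
    E : ℕ
    E = 2 ^ doublings cs
    F : ℕ
    F = E ∸ 1
    E≡1+F : E ≡ 1 + F
    E≡1+F = sym (m+[n∸m]≡n (m^n>0 2 (doublings cs)))

  closedAt≡sgn : Prime n → ∀ {k} → ¬ n ∣ k → (∀ d → 0 < d → d ≤ k → ¬ n ∣ 2 ^ d ∸ 1) →
    (cs : Vec (Fin 3) k) → closedAt cs ≡ sgn (doublings cs)
  closedAt≡sgn pr n∤k order cs with doublings cs in d≡
  ... | zero  = closedAt-translation cs d≡ n∤k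
  ... | suc d = closedAt-doubling pr cs
                  (subst (λ e → ¬ n ∣ 2 ^ e ∸ 1) (sym d≡) (order (suc d) z<s (subst (_≤ _) d≡ (doublings≤length cs))))

-- Counting choice vectors.

∑-allChoices : ∀ k (f : Vec (Fin 3) (suc k) → ℕ) → ∑ (allChoices (suc k)) f ≡
  ∑[ cs ← allChoices k ] f (fzero ∷ cs) + (∑[ cs ← allChoices k ] f (fsuc fzero ∷ cs)
    + (∑[ cs ← allChoices k ] f (fsuc (fsuc fzero) ∷ cs) + 0))
∑-allChoices k f = trans (∑-concatMap (λ c → map (c ∷_) (allChoices k)) (allFin 3) f)
  (cong₂ _+_ (∑-map _ (allChoices k) f) (cong₂ _+_ (∑-map _ (allChoices k) f)
    (cong (_+ 0) (∑-map _ (allChoices k) f))))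

∑-allChoices-1 : ∀ k → ∑[ _ ← allChoices k ] 1 ≡ 3 ^ k
∑-allChoices-1 zero    = refl
∑-allChoices-1 (suc k) = trans (∑-allChoices k (λ _ → 1)) (cong (λ t → t + (t + (t + 0))) (∑-allChoices-1 k))

-- 2^k of them avoid the doubling edge, so 3^k - 2^k use it
∑-allChoices-sgn : ∀ k → ∑[ cs ← allChoices k ] sgn (doublings cs) + 2 ^ k ≡ 3 ^ k
∑-allChoices-sgn zero    = refl
∑-allChoices-sgn (suc k) = begin
  ∑[ cs ← allChoices (suc k) ] sgn (doublings cs) + 2 ^ suc k
    ≡⟨ cong (_+ 2 ^ suc k) (∑-allChoices k (λ cs → sgn (doublings cs))) ⟩
  S + (S + (∑[ _ ← allChoices k ] 1 + 0)) + 2 * 2 ^ k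
    ≡⟨ regroup S (2 ^ k) (∑[ _ ← allChoices k ] 1) ⟩
  (S + 2 ^ k) + ((S + 2 ^ k) + (∑[ _ ← allChoices k ] 1 + 0))
    ≡⟨ cong₂ (λ t u → t + (t + (u + 0))) (∑-allChoices-sgn k) (∑-allChoices-1 k) ⟩
  3 ^ suc k ∎
  where
  open ≡-Reasoning
  S : ℕ
  S = ∑[ cs ← allChoices k ] sgn (doublings cs)
  regroup : ∀ s p t → s + (s + (t + 0)) + 2 * p ≡ s + p + (s + p + (t + 0))
  regroup = solve-∀

lemma3p1 : (n : ℕ) .{{_ : NonZero n}} → Prime n → n ≢ 2 →
    (m : ℕ) → IsMultOrder2 n m → (k : ℕ) → 1 ≤ k → k < m →
    (closedWalks n k ≡ 3 ^ k ∸ 2 ^ k)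
    × (closedWalks n k * (n * n) ≤ (n * n) * 3 ^ k)
lemma3p1 n pr n≢2 m order k 1≤k k<m = count , bound
  where
  n∤2 : ¬ n ∣ 2
  n∤2 = >⇒∤ (≤∧≢⇒< (nonTrivial⇒n>1 n {{prime⇒nonTrivial pr}}) (λ 2≡n → n≢2 (sym 2≡n)))
  n∤k : ¬ n ∣ k
  n∤k = >⇒∤ {{>-nonZero 1≤k}} (<-≤-trans k<m (order≤n pr n∤2 order))
  2^d≢1 : ∀ d → 0 < d → d ≤ k → ¬ n ∣ 2 ^ d ∸ 1
  2^d≢1 d 0<d d≤k = below-order order d 0<d (≤-<-trans d≤k k<m)

  count : closedWalks n k ≡ 3 ^ k ∸ 2 ^ k
  count = begin
    closedWalks n k                                          ≡⟨ closedWalks≡∑closedAt n k ⟩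
    ∑[ cs ← allChoices k ] closedAt n cs                     ≡⟨ ∑-cong (allChoices k) (closedAt≡sgn n pr n∤k 2^d≢1) ⟩
    ∑[ cs ← allChoices k ] sgn (doublings cs)                ≡⟨ m+n∸n≡m _ (2 ^ k) ⟨
    ∑[ cs ← allChoices k ] sgn (doublings cs) + 2 ^ k ∸ 2 ^ k ≡⟨ cong (_∸ 2 ^ k) (∑-allChoices-sgn k) ⟩
    3 ^ k ∸ 2 ^ k                                            ∎
    where open ≡-Reasoning

  bound : closedWalks n k * (n * n) ≤ (n * n) * 3 ^ k
  bound = begin
    closedWalks n k * (n * n)  ≡⟨ *-comm (closedWalks n k) (n * n) ⟩
    (n * n) * closedWalks n k  ≤⟨ *-monoʳ-≤ (n * n) (≤-trans (≤-reflexive count) (m∸n≤m (3 ^ k) (2 ^ k))) ⟩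
    (n * n) * 3 ^ k            ∎
    where open ≤-Reasoning
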